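{- Let $n,k$ be integers with $n>k\ge0$. If $k>0$, then $$\sum_{l=0}^{n-k}\binom{n-k}{l}(-1)^l\xi_{k+l,q}=q^2\sum_{l=0}^{k}\binom{k}{l}(-1)^{k+l}\xi_{n-l,1/q}.$$ Moreover (case $k=0$, i.e. $n\ge1$), $$\sum_{l=0}^{n}\binom{n}{l}(-1)^l\xi_{l,q}=[2]_q+q^2\xi_{n,1/q}.$$
   Context: Let $p$ be an odd prime, $\mathbb{C}_p$ the completion of an algebraic closure of $\mathbb{Q}_p$, and $q\in\mathbb{C}_p$ with $|1-q|_p<1$ (then also $|1-q^{ -1}|_p<1$). Put $[2]_q=1+q$. For $Q\in\{q,q^{ -1}\}$ the $Q$-Euler numbers $\xi_{n,Q}$ are defined by $\xi_{0,Q}=1$ and, for $n\ge 1$, $Q\sum_{l=0}^{n}\binom{n}{l}Q^l\xi_{l,Q}+\xi_{n,Q}=0$; $\xi_{n,1/q}$ denotes these numbers for $Q=q^{ -1}$. -}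

module Defs where

open import Level using (Level)
open import Data.Nat using (ℕ; zero; suc; _<_; _≤_; _∸_) renaming (_+_ to _+ℕ_)
open import Data.Nat.Combinatorics using (_C_)
open import Data.Product using (Σ)
open import Algebra.Bundles using (CommutativeRing; Semiring)

module QEuler {c ℓ : Level} (R : CommutativeRing c ℓ) where
  open CommutativeRing R
  open import Algebra.Definitions.RawSemiring (Semiring.rawSemiring semiring) using (_^_) public
  open import Algebra.Definitions.RawSemiring (Semiring.rawSemiring semiring) using (_×_)

  sumTo : ℕ → (ℕ → Carrier) → Carrier
  sumTo zero    f = f 0
  sumTo (suc n) f = sumTo n f + f (suc n)

  binom : ℕ → ℕ → Carrier
  binom n l = (n C l) × 1#

  IsQEuler : Carrier → (ℕ → Carrier) → Set ℓ
  IsQEuler Q ξ =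
    (ξ 0 ≈ 1#) Data.Product.×
    (∀ n → 1 ≤ n →
       Q * sumTo n (λ l → binom n l * (Q ^ l * ξ l)) + ξ n ≈ 0#)

  IsUnit : Carrier → Set (Level._⊔_ c ℓ)
  IsUnit x = Σ Carrier (λ u → x * u ≈ 1#)

  q2 : Carrier → Carrier
  q2 q = 1# + q

{-# OPTIONS --safe #-}
module Submission where

-- Write S(m) = Σ_l C(m,l) (-1)^l ξ_l. The binomial transform a ↦ Σ_l C(n,l) w^l a_l is inverted
-- by w = -1 up to the factor (-w)^n, and the q-Euler recursion says that ξ + q (Σ C(·,l) q^l ξ_l)
-- vanishes in positive degrees; transforming it back gives S(n) = [2]_q - q (-q)^n ξ_n. The sequence
-- equal to 1 at 0 and to -q⁻¹ (-q)^n ξ_n for n ≥ 1 then satisfies the recursion for q⁻¹, whose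
-- solution is unique since all 1 + q^{-j} are units; so it is ξ_{n,1/q}, which is the case k = 0.
-- For k > 0 both sides are k-fold differences m ↦ S(m) - S(m+1) of the case k = 0, in which the
-- constant [2]_q cancels.

open import Defs
open import Level using (Level; 0ℓ)
open import Algebra.Bundles using (CommutativeRing; RawRing)
import Algebra.Solver.Ring
open import Algebra.Solver.Ring.AlmostCommutativeRing
  using (AlmostCommutativeRing; fromCommutativeRing; _-Raw-AlmostCommutative⟶_; -raw-almostCommutative⟶)
open import Data.Maybe using (Maybe; nothing; just)
open import Data.Nat using (ℕ; zero; suc; _<_; _≤_; _∸_; z≤n; s≤s; _≟_)
  renaming (_+_ to _+ℕ_; _*_ to _*ℕ_)
open import Data.Nat.Properties using (m≤n⇒m<n∨m≡n; +-suc; m<n⇒0<n∸m; m+[n∸m]≡n; ≤-refl; m≤n⇒m≤1+n; <⇒≤; ≤-pred)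
open import Data.Nat.Combinatorics using (_C_; nCn≡1; nCk+nC[k+1]≡[n+1]C[k+1]; k>n⇒nCk≡0)
open import Data.Product using (_×_; _,_; proj₁)
open import Data.Sum using (inj₁; inj₂)
import Relation.Binary.PropositionalEquality as ≡
open import Relation.Nullary using (yes; no)

-- Integers, encoded as pairs (a , b) standing for a - b, serve as solver coefficients: unlike
-- elements of R they have decidable equality, so that terms can cancel.
module IntegerCoefficients {c ℓ} (R : CommutativeRing c ℓ) where
  open CommutativeRing R
  open import Algebra.Properties.Semiring.Mult.TCOptimised semiring
    using (×-homo-+; ×1-homo-*; 1+×) renaming (_×_ to _·_)
  open import Algebra.Properties.Ring ring
    using (-‿distribˡ-*; -‿distribʳ-*; -‿involutive; -0#≈0#; -‿+-comm; ⁻¹-anti-homo‿-)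
  open import Relation.Binary.Reasoning.Setoid setoid

  private
    ring′ : AlmostCommutativeRing c ℓ
    ring′ = fromCommutativeRing R

    module Plain = Algebra.Solver.Ring
      (AlmostCommutativeRing.rawRing ring′) ring′ (-raw-almostCommutative⟶ ring′) (λ _ _ → nothing)
    open Plain using (_:+_; _:-_; :-_; _:=_)

  FormalDifferences : RawRing 0ℓ 0ℓ
  FormalDifferences = record
    { Carrier = ℕ × ℕ
    ; _≈_     = ≡._≡_
    ; _+_     = λ { (a , b) (c , d) → (a +ℕ c , b +ℕ d) }
    ; _*_     = λ { (a , b) (c , d) → (a *ℕ c +ℕ b *ℕ d , a *ℕ d +ℕ b *ℕ c) }
    ; -_      = λ { (a , b) → (b , a) }
    ; 0#      = (0 , 0)
    ; 1#      = (1 , 0)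
    }

  -- Reducing to a canonical representative first makes 0, 1 and -1 denote 0#, 1# and - 1#
  -- definitionally, so that the solver's equations mention the ring constants themselves.
  ⟦_⟧ : ℕ × ℕ → Carrier
  ⟦ (a     , zero)  ⟧ = a · 1#
  ⟦ (zero  , suc b) ⟧ = - (suc b · 1#)
  ⟦ (suc a , suc b) ⟧ = ⟦ (a , b) ⟧

  ⟦⟧≈difference : ∀ a b → ⟦ (a , b) ⟧ ≈ a · 1# - b · 1#
  ⟦⟧≈difference a       zero    = sym (trans (+-congˡ -0#≈0#) (+-identityʳ _))
  ⟦⟧≈difference zero    (suc b) = sym (+-identityˡ _)
  ⟦⟧≈difference (suc a) (suc b) = begin
    ⟦ (a , b) ⟧                        ≈⟨ ⟦⟧≈difference a b ⟩
    a · 1# - b · 1#                    ≈⟨ difference-cancelˡ 1# (a · 1#) (b · 1#) ⟨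
    (1# + a · 1#) - (1# + b · 1#)      ≈⟨ +-cong (1+× a 1#) (-‿cong (1+× b 1#)) ⟨
    suc a · 1# - suc b · 1#            ∎
    where
    difference-cancelˡ : ∀ o x y → (o + x) - (o + y) ≈ x - y
    difference-cancelˡ o x y = begin
      (o + x) - (o + y)       ≈⟨ +-congˡ (-‿+-comm o y) ⟨
      (o + x) + (- o + - y)   ≈⟨ Plain.solve 3 (λ o x y → (o :+ x) :+ ((:- o) :+ (:- y)) := x :+ ((o :- o) :+ (:- y))) refl o x y ⟩
      x + ((o - o) + - y)     ≈⟨ +-congˡ (trans (+-congʳ (-‿inverseʳ o)) (+-identityˡ _)) ⟩
      x - y                   ∎

  ⟦⟧-∸ : ∀ a b → ⟦ (a , b) ⟧ ≡.≡ ⟦ (a ∸ b , b ∸ a) ⟧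
  ⟦⟧-∸ zero    zero    = ≡.refl
  ⟦⟧-∸ (suc a) zero    = ≡.refl
  ⟦⟧-∸ zero    (suc b) = ≡.refl
  ⟦⟧-∸ (suc a) (suc b) = ⟦⟧-∸ a b

  private
    difference-distrib-+ : ∀ x y z w → (x + z) - (y + w) ≈ (x - y) + (z - w)
    difference-distrib-+ = Plain.solve 4 (λ x y z w → (x :+ z) :- (y :+ w) := (x :- y) :+ (z :- w)) refl

    difference-distrib-* : ∀ x y z w → (x * z + y * w) - (x * w + y * z) ≈ (x - y) * (z - w)
    difference-distrib-* x y z w = sym (begin
      (x - y) * (z - w)                                    ≈⟨ distribʳ _ _ _ ⟩
      x * (z - w) + (- y) * (z - w)                        ≈⟨ +-cong (distribˡ _ _ _) (distribˡ _ _ _) ⟩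
      (x * z + x * (- w)) + ((- y) * z + (- y) * (- w))    ≈⟨ +-cong (+-congˡ (sym (-‿distribʳ-* x w))) (+-cong (sym (-‿distribˡ-* y z)) -y*-w≈y*w) ⟩
      (x * z + - (x * w)) + (- (y * z) + y * w)            ≈⟨ Plain.solve 4 (λ a b c d → (a :+ (:- b)) :+ ((:- c) :+ d) := (a :+ d) :- (b :+ c)) refl (x * z) (x * w) (y * z) (y * w) ⟩
      (x * z + y * w) - (x * w + y * z)                    ∎)
      where
      -y*-w≈y*w : (- y) * (- w) ≈ y * w
      -y*-w≈y*w = trans (sym (-‿distribˡ-* y (- w))) (trans (-‿cong (sym (-‿distribʳ-* y w))) (-‿involutive _))

  homomorphism : FormalDifferences -Raw-AlmostCommutative⟶ ring′
  homomorphism = record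
    { ⟦_⟧    = ⟦_⟧
    ; +-homo = λ { (a , b) (c , d) → begin
        ⟦ (a +ℕ c , b +ℕ d) ⟧                               ≈⟨ ⟦⟧≈difference (a +ℕ c) (b +ℕ d) ⟩
        (a +ℕ c) · 1# - (b +ℕ d) · 1#                       ≈⟨ +-cong (×-homo-+ 1# a c) (-‿cong (×-homo-+ 1# b d)) ⟩
        (a · 1# + c · 1#) - (b · 1# + d · 1#)               ≈⟨ difference-distrib-+ _ _ _ _ ⟩
        (a · 1# - b · 1#) + (c · 1# - d · 1#)               ≈⟨ +-cong (⟦⟧≈difference a b) (⟦⟧≈difference c d) ⟨
        ⟦ (a , b) ⟧ + ⟦ (c , d) ⟧                           ∎ }
    ; *-homo = λ { (a , b) (c , d) → begin
        ⟦ (a *ℕ c +ℕ b *ℕ d , a *ℕ d +ℕ b *ℕ c) ⟧           ≈⟨ ⟦⟧≈difference (a *ℕ c +ℕ b *ℕ d) (a *ℕ d +ℕ b *ℕ c) ⟩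
        (a *ℕ c +ℕ b *ℕ d) · 1# - (a *ℕ d +ℕ b *ℕ c) · 1#   ≈⟨ +-cong (×-homo-+-* a c b d) (-‿cong (×-homo-+-* a d b c)) ⟩
        ((a · 1#) * (c · 1#) + (b · 1#) * (d · 1#)) - ((a · 1#) * (d · 1#) + (b · 1#) * (c · 1#))
                                                            ≈⟨ difference-distrib-* _ _ _ _ ⟩
        (a · 1# - b · 1#) * (c · 1# - d · 1#)               ≈⟨ *-cong (⟦⟧≈difference a b) (⟦⟧≈difference c d) ⟨
        ⟦ (a , b) ⟧ * ⟦ (c , d) ⟧                           ∎ }
    ; -‿homo = λ { (a , b) → begin
        ⟦ (b , a) ⟧               ≈⟨ ⟦⟧≈difference b a ⟩
        b · 1# - a · 1#           ≈⟨ ⁻¹-anti-homo‿- (a · 1#) (b · 1#) ⟨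
        - (a · 1# - b · 1#)       ≈⟨ -‿cong (⟦⟧≈difference a b) ⟨
        - ⟦ (a , b) ⟧             ∎ }
    ; 0-homo = refl
    ; 1-homo = refl
    }
    where
    ×-homo-+-* : ∀ a c b d → (a *ℕ c +ℕ b *ℕ d) · 1# ≈ (a · 1#) * (c · 1#) + (b · 1#) * (d · 1#)
    ×-homo-+-* a c b d = trans (×-homo-+ 1# (a *ℕ c) (b *ℕ d)) (+-cong (×1-homo-* a c) (×1-homo-* b d))

  _≟ᶜ_ : ∀ x y → Maybe (⟦ x ⟧ ≈ ⟦ y ⟧)
  (a , b) ≟ᶜ (c , d) with a ∸ b ≟ c ∸ d | b ∸ a ≟ d ∸ c
  ... | yes a∸b≡c∸d | yes b∸a≡d∸c = just (begin
    ⟦ (a , b) ⟧              ≡⟨ ⟦⟧-∸ a b ⟩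
    ⟦ (a ∸ b , b ∸ a) ⟧      ≡⟨ ≡.cong₂ (λ x y → ⟦ (x , y) ⟧) a∸b≡c∸d b∸a≡d∸c ⟩
    ⟦ (c ∸ d , d ∸ c) ⟧      ≡⟨ ⟦⟧-∸ c d ⟨
    ⟦ (c , d) ⟧              ∎)
  ... | _ | _ = nothing

  open Algebra.Solver.Ring FormalDifferences ring′ homomorphism _≟ᶜ_ public
    using (Polynomial; con; solve; _:+_; _:*_; _:-_; :-_; _:=_)

  :0 :1 : ∀ {m} → Polynomial m
  :0 = con (0 , 0)
  :1 = con (1 , 0)

module Development {c ℓ} (R : CommutativeRing c ℓ) where
  open CommutativeRing R
  open QEuler R
  open IntegerCoefficients R using (solve; _:+_; _:*_; _:-_; :-_; _:=_; :0; :1)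
  open import Algebra.Properties.CommutativeSemigroup +-commutativeSemigroup using (interchange)
  open import Algebra.Properties.CommutativeSemiring.Exp commutativeSemiring using (^-distrib-*)
  open import Algebra.Properties.Semiring.Exp semiring using (^-congˡ)
  open import Algebra.Properties.Monoid.Mult +-monoid using (×-homo-+) renaming (_×_ to _·_)
  open import Relation.Binary.Reasoning.Setoid setoid

  sumTo-cong-≤ : ∀ n {f g : ℕ → Carrier} → (∀ l → l ≤ n → f l ≈ g l) → sumTo n f ≈ sumTo n g
  sumTo-cong-≤ zero    f≈g = f≈g 0 z≤n
  sumTo-cong-≤ (suc n) f≈g = +-cong (sumTo-cong-≤ n (λ l l≤n → f≈g l (m≤n⇒m≤1+n l≤n))) (f≈g (suc n) ≤-refl)

  sumTo-cong : ∀ n {f g : ℕ → Carrier} → (∀ l → f l ≈ g l) → sumTo n f ≈ sumTo n g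
  sumTo-cong n f≈g = sumTo-cong-≤ n (λ l _ → f≈g l)

  sumTo-distrib-+ : ∀ n (f g : ℕ → Carrier) → sumTo n (λ l → f l + g l) ≈ sumTo n f + sumTo n g
  sumTo-distrib-+ zero    f g = refl
  sumTo-distrib-+ (suc n) f g = trans (+-congʳ (sumTo-distrib-+ n f g)) (interchange _ _ _ _)

  *-distribˡ-sumTo : ∀ n a (f : ℕ → Carrier) → sumTo n (λ l → a * f l) ≈ a * sumTo n f
  *-distribˡ-sumTo zero    a f = refl
  *-distribˡ-sumTo (suc n) a f = trans (+-congʳ (*-distribˡ-sumTo n a f)) (sym (distribˡ a _ _))

  sumTo-suc : ∀ n (f : ℕ → Carrier) → sumTo (suc n) f ≈ f 0 + sumTo n (λ l → f (suc l))
  sumTo-suc zero    f = refl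
  sumTo-suc (suc n) f = trans (+-congʳ (sumTo-suc n f)) (+-assoc _ _ _)

  sumTo-head : ∀ n (f : ℕ → Carrier) → (∀ l → f (suc l) ≈ 0#) → sumTo n f ≈ f 0
  sumTo-head zero    f tail≈0 = refl
  sumTo-head (suc n) f tail≈0 = trans (+-cong (sumTo-head n f tail≈0) (tail≈0 n)) (+-identityʳ _)

  binom-zero : ∀ n → binom n 0 ≈ 1#
  binom-zero n = +-identityʳ 1#

  binom-diag : ∀ n → binom n n ≈ 1#
  binom-diag n = trans (reflexive (≡.cong (_· 1#) (nCn≡1 n))) (+-identityʳ 1#)

  binom-suc-diag : ∀ n → binom n (suc n) ≈ 0#
  binom-suc-diag n = reflexive (≡.cong (_· 1#) (k>n⇒nCk≡0 {n} (s≤s ≤-refl)))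

  binom-pascal : ∀ n l → binom (suc n) (suc l) ≈ binom n l + binom n (suc l)
  binom-pascal n l =
    trans (reflexive (≡.cong (_· 1#) (≡.sym (nCk+nC[k+1]≡[n+1]C[k+1] n l)))) (×-homo-+ 1# (n C l) (n C suc l))

  sumTo-binom-suc : ∀ n (g : ℕ → Carrier) →
    sumTo (suc n) (λ l → binom (suc n) l * g l)
    ≈ sumTo n (λ l → binom n l * g l) + sumTo n (λ l → binom n l * g (suc l))
  sumTo-binom-suc n g = begin
    sumTo (suc n) (λ l → binom (suc n) l * g l)
      ≈⟨ sumTo-suc n _ ⟩
    binom (suc n) 0 * g 0 + sumTo n (λ l → binom (suc n) (suc l) * g (suc l))
      ≈⟨ +-cong (trans (*-congʳ (binom-zero (suc n))) (*-identityˡ _))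
                (trans (sumTo-cong n (λ l → trans (*-congʳ (binom-pascal n l)) (distribʳ _ _ _))) (sumTo-distrib-+ n _ _)) ⟩
    g 0 + (shifted + upper)
      ≈⟨ solve 3 (λ x y z → x :+ (y :+ z) := (x :+ z) :+ y) refl (g 0) shifted upper ⟩
    (g 0 + upper) + shifted
      ≈⟨ +-congʳ unshifted≈ ⟨
    unshifted + shifted ∎
    where
    unshifted = sumTo n (λ l → binom n l * g l)
    shifted   = sumTo n (λ l → binom n l * g (suc l))
    upper     = sumTo n (λ l → binom n (suc l) * g (suc l))

    unshifted≈ : unshifted ≈ g 0 + upper
    unshifted≈ = begin
      unshifted                                  ≈⟨ trans (+-congˡ (trans (*-congʳ (binom-suc-diag n)) (zeroˡ _))) (+-identityʳ _) ⟨
      sumTo (suc n) (λ l → binom n l * g l)      ≈⟨ sumTo-suc n _ ⟩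
      binom n 0 * g 0 + upper                    ≈⟨ +-congʳ (trans (*-congʳ (binom-zero n)) (*-identityˡ _)) ⟩
      g 0 + upper                                ∎

  binomialTransform : Carrier → (ℕ → Carrier) → ℕ → Carrier
  binomialTransform w a n = sumTo n (λ l → binom n l * (w ^ l * a l))

  binomialTransform-cong : ∀ w n {a b : ℕ → Carrier} → (∀ l → a l ≈ b l) →
    binomialTransform w a n ≈ binomialTransform w b n
  binomialTransform-cong w n a≈b = sumTo-cong n (λ l → *-congˡ (*-congˡ (a≈b l)))

  binomialTransform-suc : ∀ w a n →
    binomialTransform w a (suc n) ≈ binomialTransform w a n + w * binomialTransform w (λ l → a (suc l)) n
  binomialTransform-suc w a n = trans (sumTo-binom-suc n (λ l → w ^ l * a l)) (+-congˡ (begin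
    sumTo n (λ l → binom n l * ((w * w ^ l) * a (suc l)))   ≈⟨ sumTo-cong n (λ l → solve 4 (λ b w p x → b :* ((w :* p) :* x) := w :* (b :* (p :* x))) refl (binom n l) w (w ^ l) (a (suc l))) ⟩
    sumTo n (λ l → w * (binom n l * (w ^ l * a (suc l))))   ≈⟨ *-distribˡ-sumTo n w _ ⟩
    w * binomialTransform w (λ l → a (suc l)) n             ∎))

  binomialTransform-linear : ∀ w (a b : ℕ → Carrier) x n →
    binomialTransform w (λ l → a l + x * b l) n ≈ binomialTransform w a n + x * binomialTransform w b n
  binomialTransform-linear w a b x n = begin
    binomialTransform w (λ l → a l + x * b l) n
      ≈⟨ sumTo-cong n (λ l → solve 5 (λ c p y x z → c :* (p :* (y :+ x :* z)) := c :* (p :* y) :+ x :* (c :* (p :* z))) refl (binom n l) (w ^ l) (a l) x (b l)) ⟩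
    sumTo n (λ l → binom n l * (w ^ l * a l) + x * (binom n l * (w ^ l * b l)))
      ≈⟨ trans (sumTo-distrib-+ n _ _) (+-congˡ (*-distribˡ-sumTo n x _)) ⟩
    binomialTransform w a n + x * binomialTransform w b n ∎

  binomialTransform-inverse : ∀ w a n →
    binomialTransform (- 1#) (binomialTransform w a) n ≈ (- w) ^ n * a n
  binomialTransform-inverse w a zero =
    solve 1 (λ x → (:1 :+ :0) :* (:1 :* ((:1 :+ :0) :* (:1 :* x))) := :1 :* x) refl (a 0)
  binomialTransform-inverse w a (suc n) = begin
    T⁻ E (suc n)                            ≈⟨ binomialTransform-suc (- 1#) E n ⟩
    T⁻ E n + (- 1#) * T⁻ (λ k → E (suc k)) n
      ≈⟨ +-congˡ (*-congˡ (trans (binomialTransform-cong (- 1#) n (λ k → binomialTransform-suc w a k))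
                                 (binomialTransform-linear (- 1#) E E′ w n))) ⟩
    T⁻ E n + (- 1#) * (T⁻ E n + w * T⁻ E′ n)
      ≈⟨ solve 3 (λ x w y → x :+ (:- :1) :* (x :+ w :* y) := (:- w) :* y) refl (T⁻ E n) w (T⁻ E′ n) ⟩
    (- w) * T⁻ E′ n                         ≈⟨ *-congˡ (binomialTransform-inverse w (λ l → a (suc l)) n) ⟩
    (- w) * ((- w) ^ n * a (suc n))         ≈⟨ *-assoc _ _ _ ⟨
    (- w) ^ suc n * a (suc n)               ∎
    where
    T⁻ = binomialTransform (- 1#)
    E  = binomialTransform w a
    E′ = binomialTransform w (λ l → a (suc l))

  ^-zeroˡ : ∀ n → 1# ^ n ≈ 1#
  ^-zeroˡ zero    = refl
  ^-zeroˡ (suc n) = trans (*-identityˡ _) (^-zeroˡ n)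

  *-cancelˡ-unit : ∀ {a x y} → IsUnit a → a * x ≈ a * y → x ≈ y
  *-cancelˡ-unit {a} {x} {y} (v , a*v≈1) a*x≈a*y = begin
    x              ≈⟨ trans (*-congʳ a*v≈1) (*-identityˡ x) ⟨
    (a * v) * x    ≈⟨ solve 3 (λ a v x → (a :* v) :* x := v :* (a :* x)) refl a v x ⟩
    v * (a * x)    ≈⟨ *-congˡ a*x≈a*y ⟩
    v * (a * y)    ≈⟨ solve 3 (λ a v y → v :* (a :* y) := (a :* v) :* y) refl a v y ⟩
    (a * v) * y    ≈⟨ trans (*-congʳ a*v≈1) (*-identityˡ y) ⟩
    y              ∎

  IsUnit-1+^-inverse : ∀ {q q⁻¹} → q * q⁻¹ ≈ 1# → ∀ j → IsUnit (1# + q ^ j) → IsUnit (1# + q⁻¹ ^ j)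
  IsUnit-1+^-inverse {q} {q⁻¹} q*q⁻¹≈1 j (u , [1+q^j]*u≈1) = q ^ j * u , (begin
    (1# + q⁻¹ ^ j) * (q ^ j * u)      ≈⟨ solve 3 (λ a b u → (:1 :+ a) :* (b :* u) := (b :+ a :* b) :* u) refl (q⁻¹ ^ j) (q ^ j) u ⟩
    (q ^ j + q⁻¹ ^ j * q ^ j) * u     ≈⟨ *-congʳ (+-congˡ q⁻¹^j*q^j≈1) ⟩
    (q ^ j + 1#) * u                  ≈⟨ *-congʳ (+-comm _ _) ⟩
    (1# + q ^ j) * u                  ≈⟨ [1+q^j]*u≈1 ⟩
    1#                                ∎)
    where
    q⁻¹^j*q^j≈1 : q⁻¹ ^ j * q ^ j ≈ 1#
    q⁻¹^j*q^j≈1 = trans (sym (^-distrib-* q⁻¹ q j)) (trans (^-congˡ j (trans (*-comm q⁻¹ q) q*q⁻¹≈1)) (^-zeroˡ j))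

  -- Uniqueness holds because the recursion at n determines (1 + Q^(n+1)) ξ_n from ξ_0, …, ξ_(n-1).
  IsQEuler-unique : ∀ {Q ξ ξ′} → (∀ j → 1 ≤ j → IsUnit (1# + Q ^ j)) →
    IsQEuler Q ξ → IsQEuler Q ξ′ → ∀ n → ξ n ≈ ξ′ n
  IsQEuler-unique {Q} {ξ} {ξ′} units (ξ0≈1 , ξ-rec) (ξ′0≈1 , ξ′-rec) n = agree n n ≤-refl
    where
    isolate-top : ∀ {A c P x} → c ≈ 1# → Q * (A + c * (P * x)) + x ≈ 0# → (1# + Q * P) * x ≈ - (Q * A)
    isolate-top {A} {c} {P} {x} c≈1 rec = begin
      (1# + Q * P) * x
        ≈⟨ solve 4 (λ Q P A x → (:1 :+ Q :* P) :* x := (Q :* (A :+ :1 :* (P :* x)) :+ x) :+ (:- (Q :* A))) refl Q P A x ⟩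
      (Q * (A + 1# * (P * x)) + x) + - (Q * A)   ≈⟨ +-congʳ (trans (+-congʳ (*-congˡ (+-congˡ (*-congʳ (sym c≈1))))) rec) ⟩
      0# + - (Q * A)                             ≈⟨ +-identityˡ _ ⟩
      - (Q * A)                                  ∎

    agree : ∀ n l → l ≤ n → ξ l ≈ ξ′ l
    agree zero    zero _ = trans ξ0≈1 (sym ξ′0≈1)
    agree (suc n) l l≤1+n with m≤n⇒m<n∨m≡n l≤1+n
    ... | inj₁ l<1+n  = agree n l (≤-pred l<1+n)
    ... | inj₂ ≡.refl = *-cancelˡ-unit (units (suc (suc n)) (s≤s z≤n)) (begin
      (1# + Q * Q ^ suc n) * ξ (suc n)    ≈⟨ isolate-top (binom-diag (suc n)) (ξ-rec (suc n) (s≤s z≤n)) ⟩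
      - (Q * lower ξ)                     ≈⟨ -‿cong (*-congˡ (sumTo-cong-≤ n (λ l l≤n → *-congˡ (*-congˡ (agree n l l≤n))))) ⟩
      - (Q * lower ξ′)                    ≈⟨ isolate-top (binom-diag (suc n)) (ξ′-rec (suc n) (s≤s z≤n)) ⟨
      (1# + Q * Q ^ suc n) * ξ′ (suc n)   ∎)
      where
      lower : (ℕ → Carrier) → Carrier
      lower ζ = sumTo n (λ l → binom (suc n) l * (Q ^ l * ζ l))

  alternatingSum-IsQEuler : ∀ {q ξ} → IsQEuler q ξ →
    ∀ n → q * ((- q) ^ n * ξ n) + binomialTransform (- 1#) ξ n ≈ 1# + q
  alternatingSum-IsQEuler {q} {ξ} (ξ0≈1 , ξ-rec) n = begin
    q * ((- q) ^ n * ξ n) + T⁻ ξ n              ≈⟨ +-comm _ _ ⟩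
    T⁻ ξ n + q * ((- q) ^ n * ξ n)              ≈⟨ +-congˡ (*-congˡ (binomialTransform-inverse q ξ n)) ⟨
    T⁻ ξ n + q * T⁻ Tq n                        ≈⟨ binomialTransform-linear (- 1#) ξ Tq q n ⟨
    T⁻ (λ l → ξ l + q * Tq l) n                 ≈⟨ sumTo-head n _ (λ l → trans (*-congˡ (trans (*-congˡ (vanishes l)) (zeroʳ _))) (zeroʳ _)) ⟩
    binom n 0 * (1# * (ξ 0 + q * (binom 0 0 * (1# * ξ 0))))
      ≈⟨ *-cong (binom-zero n) (*-congˡ (+-cong ξ0≈1 (*-congˡ (*-cong (binom-zero 0) (*-congˡ ξ0≈1))))) ⟩
    1# * (1# * (1# + q * (1# * (1# * 1#))))    ≈⟨ solve 1 (λ q → :1 :* (:1 :* (:1 :+ q :* (:1 :* (:1 :* :1)))) := :1 :+ q) refl q ⟩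
    1# + q                                      ∎
    where
    T⁻ = binomialTransform (- 1#)
    Tq = binomialTransform q ξ

    vanishes : ∀ l → ξ (suc l) + q * Tq (suc l) ≈ 0#
    vanishes l = trans (+-comm _ _) (ξ-rec (suc l) (s≤s z≤n))

  atZero : Carrier → ℕ → Carrier
  atZero x zero    = x
  atZero x (suc _) = 0#

  module Reflection {q q⁻¹ : Carrier} (q*q⁻¹≈1 : q * q⁻¹ ≈ 1#) {ξ : ℕ → Carrier} (euler : IsQEuler q ξ) where
    open import Algebra.Properties.Group +-group using (x≈y⇒x∙y⁻¹≈ε)

    reflected : ℕ → Carrier
    reflected zero    = 1#
    reflected (suc n) = - (q⁻¹ * ((- q) ^ suc n * ξ (suc n)))

    q⁻¹^l*[-q]^l≈[-1]^l : ∀ l → q⁻¹ ^ l * (- q) ^ l ≈ (- 1#) ^ l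
    q⁻¹^l*[-q]^l≈[-1]^l zero    = *-identityˡ _
    q⁻¹^l*[-q]^l≈[-1]^l (suc l) = begin
      (q⁻¹ * q⁻¹ ^ l) * ((- q) * (- q) ^ l)
        ≈⟨ solve 4 (λ a b x y → (a :* b) :* (x :* y) := (a :* x) :* (b :* y)) refl q⁻¹ (q⁻¹ ^ l) (- q) ((- q) ^ l) ⟩
      (q⁻¹ * (- q)) * (q⁻¹ ^ l * (- q) ^ l)
        ≈⟨ *-cong (trans (solve 2 (λ q⁻¹ q → q⁻¹ :* (:- q) := :- (q :* q⁻¹)) refl q⁻¹ q) (-‿cong q*q⁻¹≈1)) (q⁻¹^l*[-q]^l≈[-1]^l l) ⟩
      (- 1#) * (- 1#) ^ l ∎

    reflected-term : ∀ n l →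
      binom n l * (q⁻¹ ^ l * reflected l) ≈ (- q⁻¹) * (binom n l * ((- 1#) ^ l * ξ l)) + atZero (1# + q⁻¹) l
    reflected-term n zero = begin
      binom n 0 * (1# * 1#)                        ≈⟨ *-congʳ (binom-zero n) ⟩
      1# * (1# * 1#)                               ≈⟨ solve 1 (λ q⁻¹ → :1 :* (:1 :* :1) := (:- q⁻¹) :* (:1 :* (:1 :* :1)) :+ (:1 :+ q⁻¹)) refl q⁻¹ ⟩
      (- q⁻¹) * (1# * (1# * 1#)) + (1# + q⁻¹)      ≈⟨ +-congʳ (*-congˡ (*-cong (binom-zero n) (*-congˡ (proj₁ euler)))) ⟨
      (- q⁻¹) * (binom n 0 * (1# * ξ 0)) + (1# + q⁻¹) ∎
    reflected-term n (suc l) = begin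
      b * (q⁻¹ ^ suc l * - (q⁻¹ * ((- q) ^ suc l * x)))
        ≈⟨ solve 5 (λ b p Q m x → b :* (p :* (:- (Q :* (m :* x)))) := (:- Q) :* (b :* ((p :* m) :* x)) :+ :0) refl b (q⁻¹ ^ suc l) q⁻¹ ((- q) ^ suc l) x ⟩
      (- q⁻¹) * (b * ((q⁻¹ ^ suc l * (- q) ^ suc l) * x)) + 0#
        ≈⟨ +-congʳ (*-congˡ (*-congˡ (*-congʳ (q⁻¹^l*[-q]^l≈[-1]^l (suc l))))) ⟩
      (- q⁻¹) * (b * ((- 1#) ^ suc l * x)) + 0# ∎
      where
      b = binom n (suc l)
      x = ξ (suc l)

    reflected-IsQEuler : IsQEuler q⁻¹ reflected
    reflected-IsQEuler = refl , recursion
      where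
      recursion : ∀ n → 1 ≤ n → q⁻¹ * sumTo n (λ l → binom n l * (q⁻¹ ^ l * reflected l)) + reflected n ≈ 0#
      recursion n@(suc _) _ = begin
        q⁻¹ * sumTo n (λ l → binom n l * (q⁻¹ ^ l * reflected l)) + reflected n
          ≈⟨ +-congʳ (*-congˡ (begin
               sumTo n (λ l → binom n l * (q⁻¹ ^ l * reflected l))            ≈⟨ sumTo-cong n (reflected-term n) ⟩
               sumTo n (λ l → (- q⁻¹) * (binom n l * ((- 1#) ^ l * ξ l)) + atZero (1# + q⁻¹) l)
                 ≈⟨ trans (sumTo-distrib-+ n _ _) (+-cong (*-distribˡ-sumTo n (- q⁻¹) _) (sumTo-head n _ (λ _ → refl))) ⟩
               (- q⁻¹) * S + (1# + q⁻¹)                                        ∎)) ⟩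
        q⁻¹ * ((- q⁻¹) * S + (1# + q⁻¹)) + - (q⁻¹ * X)
          ≈⟨ solve 4 (λ q Q S X → Q :* ((:- Q) :* S :+ (:1 :+ Q)) :+ (:- (Q :* X))
                               := (Q :* (:- Q)) :* ((q :* X :+ S) :- (:1 :+ q)) :+ (Q :- Q :* X) :* (:1 :- q :* Q)) refl q q⁻¹ S X ⟩
        (q⁻¹ * (- q⁻¹)) * ((q * X + S) - (1# + q)) + (q⁻¹ - q⁻¹ * X) * (1# - q * q⁻¹)
          ≈⟨ +-cong (*-congˡ (x≈y⇒x∙y⁻¹≈ε (alternatingSum-IsQEuler euler n))) (*-congˡ (x≈y⇒x∙y⁻¹≈ε (sym q*q⁻¹≈1))) ⟩
        (q⁻¹ * (- q⁻¹)) * 0# + (q⁻¹ - q⁻¹ * X) * 0#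
          ≈⟨ trans (+-cong (zeroʳ _) (zeroʳ _)) (+-identityʳ _) ⟩
        0# ∎
        where
        S = binomialTransform (- 1#) ξ n
        X = (- q) ^ n * ξ n

    alternatingSum-reflected : ∀ n → 1 ≤ n → binomialTransform (- 1#) ξ n ≈ (1# + q) + q ^ 2 * reflected n
    alternatingSum-reflected n@(suc _) _ = begin
      S                          ≈⟨ solve 2 (λ S Y → S := (Y :+ S) :- Y) refl S (q * X) ⟩
      (q * X + S) - q * X        ≈⟨ +-congʳ (alternatingSum-IsQEuler euler n) ⟩
      (1# + q) - q * X           ≈⟨ +-congˡ q²*reflected≈-qX ⟨
      (1# + q) + q ^ 2 * reflected n ∎
      where
      S = binomialTransform (- 1#) ξ n
      X = (- q) ^ n * ξ n

      q²*reflected≈-qX : q ^ 2 * reflected n ≈ - (q * X)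
      q²*reflected≈-qX = begin
        (q * (q * 1#)) * - (q⁻¹ * X)   ≈⟨ solve 3 (λ q Q X → (q :* (q :* :1)) :* (:- (Q :* X)) := :- ((q :* Q) :* (q :* X))) refl q q⁻¹ X ⟩
        - ((q * q⁻¹) * (q * X))        ≈⟨ -‿cong (trans (*-congʳ q*q⁻¹≈1) (*-identityˡ _)) ⟩
        - (q * X)                      ∎

  module ShiftedSums (a b : ℕ → Carrier) (c r : Carrier)
    (alternatingSum≈ : ∀ m → 1 ≤ m → binomialTransform (- 1#) a m ≈ c + r * b m) where

    shifted : ℕ → ℕ → Carrier
    shifted k = binomialTransform (- 1#) (λ l → a (k +ℕ l))

    reversed : ℕ → ℕ → Carrier
    reversed n k = sumTo k (λ l → binom k l * ((- 1#) ^ (k +ℕ l) * b (n ∸ l)))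

    shifted-suc : ∀ k m → shifted (suc k) m ≈ shifted k m - shifted k (suc m)
    shifted-suc k m = begin
      shifted (suc k) m                                   ≈⟨ solve 2 (λ x z → z := x :- (x :+ (:- :1) :* z)) refl (shifted k m) (shifted (suc k) m) ⟩
      shifted k m - (shifted k m + (- 1#) * shifted (suc k) m)
        ≈⟨ +-congˡ (-‿cong (begin
             shifted k m + (- 1#) * shifted (suc k) m
               ≈⟨ +-congˡ (*-congˡ (binomialTransform-cong (- 1#) m (λ l → reflexive (≡.cong a (+-suc k l))))) ⟨
             shifted k m + (- 1#) * binomialTransform (- 1#) (λ l → a (k +ℕ suc l)) m
               ≈⟨ binomialTransform-suc (- 1#) (λ l → a (k +ℕ l)) m ⟨
             shifted k (suc m) ∎)) ⟩
      shifted k m - shifted k (suc m)                     ∎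

    reversed-zero : ∀ n → reversed n 0 ≈ b n
    reversed-zero n = trans (*-cong (binom-zero 0) (*-identityˡ _)) (*-identityˡ _)

    reversed-suc : ∀ n k → reversed (suc n) (suc k) ≈ (- 1#) * reversed (suc n) k + reversed n k
    reversed-suc n k = trans (sumTo-binom-suc k g) (+-cong
      (trans (sumTo-cong k (λ l → solve 4 (λ c m p x → c :* ((m :* p) :* x) := m :* (c :* (p :* x))) refl
                                          (binom k l) (- 1#) ((- 1#) ^ (k +ℕ l)) (b (suc n ∸ l))))
             (*-distribˡ-sumTo k (- 1#) _))
      (sumTo-cong k (λ l → *-congˡ (*-congʳ (sign l)))))
      where
      g : ℕ → Carrier
      g l = (- 1#) ^ (suc k +ℕ l) * b (suc n ∸ l)

      sign : ∀ l → (- 1#) ^ (suc k +ℕ suc l) ≈ (- 1#) ^ (k +ℕ l)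
      sign l = trans (*-congˡ (reflexive (≡.cong ((- 1#) ^_) (+-suc k l))))
                     (solve 1 (λ p → (:- :1) :* ((:- :1) :* p) := p) refl ((- 1#) ^ (k +ℕ l)))

    shifted≈reversed : ∀ k m → 1 ≤ m → shifted (suc k) m ≈ r * reversed (suc k +ℕ m) (suc k)
    shifted≈reversed zero m 1≤m = begin
      shifted 1 m                                      ≈⟨ shifted-suc 0 m ⟩
      shifted 0 m - shifted 0 (suc m)                  ≈⟨ +-cong (alternatingSum≈ m 1≤m) (-‿cong (alternatingSum≈ (suc m) (s≤s z≤n))) ⟩
      (c + r * b m) - (c + r * b (suc m))
        ≈⟨ solve 4 (λ c r x y → (c :+ r :* x) :- (c :+ r :* y) := r :* ((:- :1) :* y :+ x)) refl c r (b m) (b (suc m)) ⟩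
      r * ((- 1#) * b (suc m) + b m)                   ≈⟨ *-congˡ (trans (reversed-suc m 0) (+-cong (*-congˡ (reversed-zero (suc m))) (reversed-zero m))) ⟨
      r * reversed (suc m) 1                           ∎
    shifted≈reversed (suc k) m 1≤m = begin
      shifted (suc (suc k)) m                          ≈⟨ shifted-suc (suc k) m ⟩
      shifted (suc k) m - shifted (suc k) (suc m)      ≈⟨ +-cong (shifted≈reversed k m 1≤m) (-‿cong (shifted≈reversed k (suc m) (s≤s z≤n))) ⟩
      r * reversed (suc k +ℕ m) (suc k) - r * reversed (suc k +ℕ suc m) (suc k)
        ≈⟨ +-congˡ (-‿cong (*-congˡ (reflexive (≡.cong (λ n → reversed n (suc k)) (+-suc (suc k) m))))) ⟩
      r * x - r * y                                    ≈⟨ solve 3 (λ r x y → r :* x :- r :* y := r :* ((:- :1) :* y :+ x)) refl r x y ⟩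
      r * ((- 1#) * y + x)                             ≈⟨ *-congˡ (reversed-suc (suc k +ℕ m) (suc k)) ⟨
      r * reversed (suc (suc k) +ℕ m) (suc (suc k))    ∎
      where
      x = reversed (suc k +ℕ m) (suc k)
      y = reversed (suc (suc k +ℕ m)) (suc k)

open import Data.Nat using (_+_)

corollary7 : {c ℓ : Level} (R : CommutativeRing c ℓ) →
    let open CommutativeRing R renaming (_+_ to _⊕_) in
    let open QEuler R in
    (q q⁻¹ : Carrier) → q * q⁻¹ ≈ 1# →
    (∀ j → 1 ≤ j → IsUnit (1# ⊕ q ^ j)) →
    (ξ ξ' : ℕ → Carrier) → IsQEuler q ξ → IsQEuler q⁻¹ ξ' →
    ((n k : ℕ) → 0 < k → k < n →
       sumTo (n ∸ k) (λ l → binom (n ∸ k) l * ((- 1#) ^ l * ξ (k + l)))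
       ≈ q ^ 2 * sumTo k (λ l → binom k l * ((- 1#) ^ (k + l) * ξ' (n ∸ l))))
    ×
    ((n : ℕ) → 1 ≤ n →
       sumTo n (λ l → binom n l * ((- 1#) ^ l * ξ l))
       ≈ q2 q ⊕ q ^ 2 * ξ' n)
corollary7 R q q⁻¹ q*q⁻¹≈1 units ξ ξ′ euler euler′ = shiftedCase , unshiftedCase
  where
  open CommutativeRing R renaming (_+_ to _⊕_)
  open QEuler R
  open Development R
  open Reflection q*q⁻¹≈1 euler

  ξ′≈reflected : ∀ n → ξ′ n ≈ reflected n
  ξ′≈reflected = IsQEuler-unique (λ j 1≤j → IsUnit-1+^-inverse q*q⁻¹≈1 j (units j 1≤j)) euler′ reflected-IsQEuler

  unshiftedCase : ∀ n → 1 ≤ n → binomialTransform (- 1#) ξ n ≈ q2 q ⊕ q ^ 2 * ξ′ n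
  unshiftedCase n 1≤n = trans (alternatingSum-reflected n 1≤n) (+-congˡ (*-congˡ (sym (ξ′≈reflected n))))

  open ShiftedSums ξ ξ′ (q2 q) (q ^ 2) unshiftedCase

  shiftedCase : ∀ n k → 0 < k → k < n → shifted k (n ∸ k) ≈ q ^ 2 * reversed n k
  shiftedCase n (suc k) _ k<n = trans (shifted≈reversed k (n ∸ suc k) (m<n⇒0<n∸m k<n))
    (*-congˡ (reflexive (≡.cong (λ m → reversed m (suc k)) (m+[n∸m]≡n (<⇒≤ k<n)))))
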